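{- Let $r$ and $t$ be integers. Then $$\gamma_{R}(K_r\times K_t)=\begin{cases}4, & \text{if } t\geq r=2,\\ 5, & \text{if } t\geq r=3,\\ 6, & \text{if } t\geq r>3.\end{cases}$$
   Context: All graphs are finite and simple. $K_n$ is the complete graph on $n$ vertices. The direct product $G\times H$ has vertex set $V(G)\times V(H)$, and $(u,v)$ is adjacent to $(u',v')$ iff $uu'\in E(G)$ and $vv'\in E(H)$. A Roman dominating function (RDF) on a graph $G$ is a function $f:V(G)\to\{0,1,2\}$ such that every vertex $v$ with $f(v)=0$ is adjacent to some vertex $u$ with $f(u)=2$. Its weight is $\omega(f)=\sum_{v\in V(G)}f(v)$, and the Roman domination number $\gamma_R(G)$ is the minimum weight of an RDF on $G$. -}

module Defs where

open import Data.Nat using (ℕ; _≤_; _*_)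
open import Data.Fin using (Fin; zero; suc; toℕ; quotient; remainder)
open import Data.List using (map; allFin)
open import Data.Nat.ListAction using (sum)
open import Data.Product using (_×_; _,_; ∃; ∃-syntax; proj₁; proj₂)
open import Relation.Binary.PropositionalEquality using (_≡_; _≢_; refl; sym)
open import Relation.Nullary using (¬_)

record Graph (n : ℕ) : Set₁ where
  field
    Adj     : Fin n → Fin n → Set
    symm    : ∀ {u v} → Adj u v → Adj v u
    irrefl  : ∀ {u} → ¬ Adj u u
open Graph public

K : (n : ℕ) → Graph n
K n = record
  { Adj    = λ u v → u ≢ v
  ; symm   = λ u≢v v≡u → u≢v (sym v≡u)
  ; irrefl = λ u≢u → u≢u refl
  }

-- Direct product G × H; the vertex set Fin (m * n) is identified with
-- Fin m × Fin n via the library bijection remQuot (quotient, remainder).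
_×ᵍ_ : ∀ {m n} → Graph m → Graph n → Graph (m * n)
_×ᵍ_ {m} {n} G H = record
  { Adj    = λ x y → Adj G (quotient n x) (quotient n y)
                   × Adj H (remainder {m} n x) (remainder {m} n y)
  ; symm   = λ p → symm G (proj₁ p) , symm H (proj₂ p)
  ; irrefl = λ p → irrefl G (proj₁ p)
  }

two : Fin 3
two = suc (suc zero)

IsRDF : ∀ {n} → Graph n → (Fin n → Fin 3) → Set
IsRDF G f = ∀ v → f v ≡ zero → ∃[ u ] (Adj G v u × f u ≡ two)

weight : ∀ {n} → (Fin n → Fin 3) → ℕ
weight {n} f = sum (map (λ v → toℕ (f v)) (allFin n))

RomanDominationNumber : ∀ {n} → Graph n → ℕ → Set
RomanDominationNumber G k =
  (∃[ f ] (IsRDF G f × weight f ≡ k)) × (∀ f → IsRDF G f → k ≤ weight f)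

-- View K r ×ᵍ K t as the cells of an r × t board, two cells being adjacent exactly when they
-- share neither a row nor a column. A cell of value 0 that shares a line with a cell of value 2
-- is not dominated by it, so it forces yet another cell of value 2. If no cell has value 2, all
-- r t cells are nonzero. Otherwise take a cell of value 2: its row and column neighbours are
-- either all nonzero or produce a second 2; two cells of value 2 share a line with one further
-- cell when r, t ≥ 3 and with two when r, t ≥ 4, and these are nonzero or produce a third 2.
-- Counting gives the lower bounds 4, 5 and 6. They are attained by the values 2, 2 on the first
-- column (r = 2), 2, 2, 1 on the first column (r = 3), and 2 on three diagonal cells (r ≥ 4).
module Submission where

open import Defs
open import Data.Empty using (⊥-elim)
open import Data.Fin using (Fin; zero; suc; toℕ; combine; remQuot; _≟_)
open import Data.Fin.Properties using (any?; remQuot-combine; combine-remQuot)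
open import Data.List using (List; []; _∷_; _++_; [_]; map; length; allFin)
open import Data.List.Properties using (map-++; map-∘; map-cong; length-tabulate)
open import Data.List.Membership.Propositional using (_∈_; find)
open import Data.List.Membership.Propositional.Properties using (∈-∃++; ∈-allFin; ∈-map⁺)
open import Data.List.Relation.Binary.Permutation.Propositional.Properties using (shift; ∈-resp-↭)
  renaming (map⁺ to ↭-map⁺)
open import Data.List.Relation.Unary.All as All using (All; []; _∷_)
open import Data.List.Relation.Unary.All.Properties using (¬Any⇒All¬; ¬All⇒Any¬; tabulate⁺)
open import Data.List.Relation.Unary.AllPairs using ([]; _∷_)
open import Data.List.Relation.Unary.Any as Any using (here; there)
open import Data.List.Relation.Unary.Unique.Propositional using (Unique)
open import Data.List.Relation.Unary.Unique.Propositional.Properties using (allFin⁺; map⁺)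
open import Data.Nat using (ℕ; _≤_; _<_; _+_; _*_; z≤n; s≤s)
open import Data.Nat.ListAction using (sum)
open import Data.Nat.ListAction.Properties using (sum-++; sum-↭)
open import Data.Nat.Properties using (≤-refl; ≤-trans; <⇒≤; n≤1+n; m≤m+n; *-mono-≤; ≤-reflexive; ≤-antisym; <⇒≱; +-mono-≤; +-monoʳ-≤; *-identityʳ; module ≤-Reasoning)
  renaming (_≟_ to _≟ℕ_)
open import Data.Product using (_×_; _,_; ∃; proj₁; proj₂; uncurry)
open import Data.Product.Properties using (≡-dec)
open import Data.Sum using (_⊎_; inj₁; inj₂)
open import Function using (_∘_; id)
open import Relation.Nullary using (¬_; yes; no)
open import Relation.Nullary.Decidable using (¬?; decidable-stable)
open import Relation.Binary.PropositionalEquality using (_≡_; _≢_; refl; sym; trans; cong; subst)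

sum-map-≤ : ∀ {A : Set} (g : A → ℕ) {xs ys : List A} → Unique ys →
            (∀ {y} → y ∈ ys → g y ≢ 0 → y ∈ xs) → sum (map g ys) ≤ sum (map g xs)
sum-map-≤ g {ys = []} _ _ = z≤n
sum-map-≤ g {ys = y ∷ ys} (y∉ys ∷ ys!) support with g y ≟ℕ 0
... | yes gy≡0 rewrite gy≡0 = sum-map-≤ g ys! (support ∘ there)
... | no gy≢0 with ∈-∃++ (support (here refl) gy≢0)
...   | xs₁ , xs₂ , refl = begin
  g y + sum (map g ys)              ≤⟨ +-monoʳ-≤ (g y) (sum-map-≤ g ys! support′) ⟩
  g y + sum (map g (xs₁ ++ xs₂))    ≡⟨ sum-↭ (↭-map⁺ g (shift y xs₁ xs₂)) ⟨
  sum (map g (xs₁ ++ [ y ] ++ xs₂)) ∎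
  where
  open ≤-Reasoning
  support′ : ∀ {z} → z ∈ ys → g z ≢ 0 → z ∈ xs₁ ++ xs₂
  support′ z∈ys gz≢0 with ∈-resp-↭ (shift y xs₁ xs₂) (support (there z∈ys) gz≢0)
  ... | here z≡y  = ⊥-elim (All.lookup y∉ys z∈ys (sym z≡y))
  ... | there z∈ = z∈

sum-map-1 : ∀ {A : Set} (xs : List A) → sum (map (λ _ → 1) xs) ≡ length xs
sum-map-1 []       = refl
sum-map-1 (_ ∷ xs) = cong (1 +_) (sum-map-1 xs)

length*≤sum-map : ∀ {A : Set} {c} (g : A → ℕ) {xs} → All (λ x → c ≤ g x) xs → length xs * c ≤ sum (map g xs)
length*≤sum-map g []             = z≤n
length*≤sum-map g (c≤gx ∷ c≤gxs) = +-mono-≤ c≤gx (length*≤sum-map g c≤gxs)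

fresh : ∀ {n} (xs : List (Fin n)) → length xs < n → ∃ λ y → All (_≢ y) xs
fresh {n} xs |xs|<n with any? (λ y → ¬? (Any.any? (y ≟_) xs))
... | yes (y , y∉xs) = y , All.map (_∘ sym) (¬Any⇒All¬ xs y∉xs)
... | no ¬∃y∉xs = ⊥-elim (<⇒≱ |xs|<n n≤|xs|)
  where
  open ≤-Reasoning
  n≤|xs| : n ≤ length xs
  n≤|xs| = begin
    n                              ≡⟨ length-tabulate id ⟨
    length (allFin n)              ≡⟨ sum-map-1 (allFin n) ⟨
    sum (map (λ _ → 1) (allFin n)) ≤⟨ sum-map-≤ (λ _ → 1) (allFin⁺ n) (λ {y} _ _ →
                                        decidable-stable (Any.any? (y ≟_) xs) (¬∃y∉xs ∘ (y ,_))) ⟩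
    sum (map (λ _ → 1) xs)         ≡⟨ sum-map-1 xs ⟩
    length xs                      ∎

1≤toℕ : ∀ {n} {x : Fin (1 + n)} → x ≢ zero → 1 ≤ toℕ x
1≤toℕ {x = zero}  x≢0 = ⊥-elim (x≢0 refl)
1≤toℕ {x = suc _} _   = s≤s z≤n

Cell : ℕ → ℕ → Set
Cell r t = Fin r × Fin t

vertex : ∀ {r t} → Cell r t → Fin (r * t)
vertex = uncurry combine

-- Adj (K r ×ᵍ K t) u v unfolds to Apart (remQuot t u) (remQuot t v).
Apart : ∀ {r t} → Cell r t → Cell r t → Set
Apart p q = proj₁ p ≢ proj₁ q × proj₂ p ≢ proj₂ q

Collinear : ∀ {r t} → Cell r t → Cell r t → Set
Collinear p q = proj₁ p ≡ proj₁ q ⊎ proj₂ p ≡ proj₂ q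

collinear⇒¬apart : ∀ {r t} {p q : Cell r t} → Collinear p q → ¬ Apart p q
collinear⇒¬apart (inj₁ same-row)    (rows≢ , _) = rows≢ same-row
collinear⇒¬apart (inj₂ same-column) (_ , cols≢) = cols≢ same-column

≢-by-row : ∀ {r t} {a c : Fin r} {b d : Fin t} → a ≢ c → (a , b) ≢ (c , d)
≢-by-row a≢c = a≢c ∘ cong proj₁

≢-by-column : ∀ {r t} {a c : Fin r} {b d : Fin t} → b ≢ d → (a , b) ≢ (c , d)
≢-by-column b≢d = b≢d ∘ cong proj₂

IsCellRDF : ∀ {r t} → (Cell r t → Fin 3) → Set
IsCellRDF F = ∀ p → F p ≡ zero → ∃ λ q → Apart p q × F q ≡ two

module _ {r t : ℕ} where

  vertex-injective : ∀ {p q : Cell r t} → vertex p ≡ vertex q → p ≡ q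
  vertex-injective {i , j} {k , l} eq =
    trans (sym (remQuot-combine i j)) (trans (cong (remQuot t) eq) (remQuot-combine k l))

  IsRDF⇒IsCellRDF : ∀ {f} → IsRDF (K r ×ᵍ K t) f → IsCellRDF (f ∘ vertex)
  IsRDF⇒IsCellRDF {f} rdf (i , j) f[i,j]≡0 with rdf (combine i j) f[i,j]≡0
  ... | u , adj , fu≡2 =
    remQuot t u ,
    subst (λ p → Apart p (remQuot t u)) (remQuot-combine i j) adj ,
    trans (cong f (combine-remQuot {r} t u)) fu≡2

  IsCellRDF⇒IsRDF : ∀ {F} → IsCellRDF F → IsRDF (K r ×ᵍ K t) (F ∘ remQuot t)
  IsCellRDF⇒IsRDF {F} rdf u Fu≡0 with rdf (remQuot t u) Fu≡0
  ... | (i , j) , apart , F[i,j]≡2 =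
    combine i j ,
    subst (Apart (remQuot t u)) (sym (remQuot-combine i j)) apart ,
    trans (cong F (remQuot-combine i j)) F[i,j]≡2

  weight-≥ : ∀ (f : Fin (r * t) → Fin 3) {ps} → Unique ps → sum (map (toℕ ∘ f ∘ vertex) ps) ≤ weight f
  weight-≥ f {ps} ps! = begin
    sum (map (toℕ ∘ f ∘ vertex) ps)     ≡⟨ cong sum (map-∘ ps) ⟩
    sum (map (toℕ ∘ f) (map vertex ps)) ≤⟨ sum-map-≤ (toℕ ∘ f) (map⁺ vertex-injective ps!) (λ _ _ → ∈-allFin _) ⟩
    weight f                            ∎
    where open ≤-Reasoning

  weight-≤ : ∀ (F : Cell r t → Fin 3) {ps} → (∀ p → F p ≢ zero → p ∈ ps) →
             weight (F ∘ remQuot t) ≤ sum (map (toℕ ∘ F) ps)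
  weight-≤ F {ps} support = begin
    weight (F ∘ remQuot t)                            ≤⟨ sum-map-≤ (toℕ ∘ F ∘ remQuot t) (allFin⁺ (r * t)) support′ ⟩
    sum (map (toℕ ∘ F ∘ remQuot t) (map vertex ps))   ≡⟨ cong sum (map-∘ ps) ⟨
    sum (map (toℕ ∘ F ∘ remQuot t ∘ vertex) ps)       ≡⟨ cong sum (map-cong (λ (i , j) → cong (toℕ ∘ F) (remQuot-combine i j)) ps) ⟩
    sum (map (toℕ ∘ F) ps)                            ∎
    where
    open ≤-Reasoning
    support′ : ∀ {u} → u ∈ allFin (r * t) → toℕ (F (remQuot t u)) ≢ 0 → u ∈ map vertex ps
    support′ {u} _ nonzero = subst (_∈ map vertex ps) (combine-remQuot {r} t u)
                               (∈-map⁺ vertex (support (remQuot t u) (nonzero ∘ cong toℕ)))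

assign : ∀ {r t} → List (Cell r t × Fin 3) → Cell r t → Fin 3
assign []              p = zero
assign ((q , v) ∷ qvs) p with ≡-dec _≟_ _≟_ p q
... | yes _ = v
... | no _  = assign qvs p

assign-support : ∀ {r t} (qvs : List (Cell r t × Fin 3)) p → assign qvs p ≢ zero → p ∈ map proj₁ qvs
assign-support []              p nonzero = ⊥-elim (nonzero refl)
assign-support ((q , v) ∷ qvs) p nonzero with ≡-dec _≟_ _≟_ p q
... | yes p≡q = here p≡q
... | no _    = there (assign-support qvs p nonzero)

RomanDominationNumber-intro :
  ∀ {r t m} → (∀ f → IsRDF (K r ×ᵍ K t) f → m ≤ weight f) →
  (qvs : List (Cell r t × Fin 3)) → IsCellRDF (assign qvs) →
  sum (map (toℕ ∘ assign qvs) (map proj₁ qvs)) ≤ m → RomanDominationNumber (K r ×ᵍ K t) m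
RomanDominationNumber-intro {r} {t} lower qvs rdf weight≤m =
  (f , rdf′ , ≤-antisym (≤-trans (weight-≤ (assign qvs) (assign-support qvs)) weight≤m) (lower f rdf′)) , lower
  where
  f : Fin (r * t) → Fin 3
  f = assign qvs ∘ remQuot t
  rdf′ : IsRDF (K r ×ᵍ K t) f
  rdf′ = IsCellRDF⇒IsRDF rdf

CollinearExtension : ∀ {r t} → List (Cell r t) → ℕ → Set
CollinearExtension hs k =
  ∃ λ ws → length ws ≡ k × Unique (hs ++ ws) × All (λ w → All (Collinear w) hs) ws

module _ {r t : ℕ} where

  neighbours₂ : 1 < r → 1 < t → (p : Cell r t) → CollinearExtension [ p ] 2
  neighbours₂ 1<r 1<t (a , b) with fresh [ b ] 1<t | fresh [ a ] 1<r
  ... | y , b≢y ∷ [] | x , a≢x ∷ [] =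
    (a , y) ∷ (x , b) ∷ [] , refl ,
    (≢-by-column b≢y ∷ ≢-by-row a≢x ∷ []) ∷ (≢-by-row a≢x ∷ []) ∷ [] ∷ [] ,
    (inj₁ refl ∷ []) ∷ (inj₂ refl ∷ []) ∷ []

  neighbours₄ : 2 < r → 2 < t → (p : Cell r t) → CollinearExtension [ p ] 4
  neighbours₄ 2<r 2<t (a , b) with fresh [ b ] (<⇒≤ 2<t) | fresh [ a ] (<⇒≤ 2<r)
  ... | y₁ , b≢y₁ ∷ [] | x₁ , a≢x₁ ∷ [] with fresh (b ∷ y₁ ∷ []) 2<t | fresh (a ∷ x₁ ∷ []) 2<r
  ... | y₂ , b≢y₂ ∷ y₁≢y₂ ∷ [] | x₂ , a≢x₂ ∷ x₁≢x₂ ∷ [] =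
    (a , y₁) ∷ (a , y₂) ∷ (x₁ , b) ∷ (x₂ , b) ∷ [] , refl ,
    (≢-by-column b≢y₁ ∷ ≢-by-column b≢y₂ ∷ ≢-by-row a≢x₁ ∷ ≢-by-row a≢x₂ ∷ []) ∷
    (≢-by-column y₁≢y₂ ∷ ≢-by-row a≢x₁ ∷ ≢-by-row a≢x₂ ∷ []) ∷
    (≢-by-row a≢x₁ ∷ ≢-by-row a≢x₂ ∷ []) ∷
    (≢-by-row x₁≢x₂ ∷ []) ∷ [] ∷ [] ,
    (inj₁ refl ∷ []) ∷ (inj₁ refl ∷ []) ∷ (inj₂ refl ∷ []) ∷ (inj₂ refl ∷ []) ∷ []

  commonCells₁ : 2 < r → 2 < t → {p q : Cell r t} → Unique (q ∷ p ∷ []) → CollinearExtension (q ∷ p ∷ []) 1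
  commonCells₁ 2<r 2<t {a , b} {c , d} ((q≢p ∷ []) ∷ _) with c ≟ a | d ≟ b
  ... | yes refl | yes refl = ⊥-elim (q≢p refl)
  ... | yes refl | no d≢b with fresh (d ∷ b ∷ []) 2<t
  ...   | y , d≢y ∷ b≢y ∷ [] =
    [ (c , y) ] , refl ,
    (q≢p ∷ ≢-by-column d≢y ∷ []) ∷ (≢-by-column b≢y ∷ []) ∷ [] ∷ [] ,
    (inj₁ refl ∷ inj₁ refl ∷ []) ∷ []
  commonCells₁ 2<r 2<t {a , b} {c , d} ((q≢p ∷ []) ∷ _) | no c≢a | yes refl with fresh (c ∷ a ∷ []) 2<r
  ...   | x , c≢x ∷ a≢x ∷ [] =
    [ (x , d) ] , refl ,
    (q≢p ∷ ≢-by-row c≢x ∷ []) ∷ (≢-by-row a≢x ∷ []) ∷ [] ∷ [] ,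
    (inj₂ refl ∷ inj₂ refl ∷ []) ∷ []
  commonCells₁ 2<r 2<t {a , b} {c , d} ((q≢p ∷ []) ∷ _) | no c≢a | no d≢b =
    [ (c , b) ] , refl ,
    (q≢p ∷ ≢-by-column d≢b ∷ []) ∷ (≢-by-row (c≢a ∘ sym) ∷ []) ∷ [] ∷ [] ,
    (inj₁ refl ∷ inj₂ refl ∷ []) ∷ []

  commonCells₂ : 3 < r → 3 < t → {p q : Cell r t} → Unique (q ∷ p ∷ []) → CollinearExtension (q ∷ p ∷ []) 2
  commonCells₂ 3<r 3<t {a , b} {c , d} ((q≢p ∷ []) ∷ _) with c ≟ a | d ≟ b
  ... | yes refl | yes refl = ⊥-elim (q≢p refl)
  ... | yes refl | no d≢b with fresh (d ∷ b ∷ []) (<⇒≤ 3<t)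
  ...   | y₁ , d≢y₁ ∷ b≢y₁ ∷ [] with fresh (d ∷ b ∷ y₁ ∷ []) 3<t
  ...     | y₂ , d≢y₂ ∷ b≢y₂ ∷ y₁≢y₂ ∷ [] =
    (c , y₁) ∷ (c , y₂) ∷ [] , refl ,
    (q≢p ∷ ≢-by-column d≢y₁ ∷ ≢-by-column d≢y₂ ∷ []) ∷
    (≢-by-column b≢y₁ ∷ ≢-by-column b≢y₂ ∷ []) ∷
    (≢-by-column y₁≢y₂ ∷ []) ∷ [] ∷ [] ,
    (inj₁ refl ∷ inj₁ refl ∷ []) ∷ (inj₁ refl ∷ inj₁ refl ∷ []) ∷ []
  commonCells₂ 3<r 3<t {a , b} {c , d} ((q≢p ∷ []) ∷ _) | no c≢a | yes refl with fresh (c ∷ a ∷ []) (<⇒≤ 3<r)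
  ...   | x₁ , c≢x₁ ∷ a≢x₁ ∷ [] with fresh (c ∷ a ∷ x₁ ∷ []) 3<r
  ...     | x₂ , c≢x₂ ∷ a≢x₂ ∷ x₁≢x₂ ∷ [] =
    (x₁ , d) ∷ (x₂ , d) ∷ [] , refl ,
    (q≢p ∷ ≢-by-row c≢x₁ ∷ ≢-by-row c≢x₂ ∷ []) ∷
    (≢-by-row a≢x₁ ∷ ≢-by-row a≢x₂ ∷ []) ∷
    (≢-by-row x₁≢x₂ ∷ []) ∷ [] ∷ [] ,
    (inj₂ refl ∷ inj₂ refl ∷ []) ∷ (inj₂ refl ∷ inj₂ refl ∷ []) ∷ []
  commonCells₂ 3<r 3<t {a , b} {c , d} ((q≢p ∷ []) ∷ _) | no c≢a | no d≢b =
    (c , b) ∷ (a , d) ∷ [] , refl ,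
    (q≢p ∷ ≢-by-column d≢b ∷ ≢-by-row c≢a ∷ []) ∷
    (≢-by-row (c≢a ∘ sym) ∷ ≢-by-column (d≢b ∘ sym) ∷ []) ∷
    (≢-by-row c≢a ∷ []) ∷ [] ∷ [] ,
    (inj₁ refl ∷ inj₂ refl ∷ []) ∷ (inj₂ refl ∷ inj₁ refl ∷ []) ∷ []

module LowerBounds {r t} {f : Fin (r * t) → Fin 3} (rdf : IsRDF (K r ×ᵍ K t) f) where

  Heavy : Cell r t → Set
  Heavy p = f (vertex p) ≡ two

  weight-≥-count : ∀ {hs ws} → All Heavy hs → All (λ w → f (vertex w) ≢ zero) ws → Unique (hs ++ ws) →
                   length hs * 2 + length ws ≤ weight f
  weight-≥-count {hs} {ws} heavy nonzero hs++ws! = begin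
    length hs * 2 + length ws          ≡⟨ cong (length hs * 2 +_) (*-identityʳ (length ws)) ⟨
    length hs * 2 + length ws * 1      ≤⟨ +-mono-≤ (length*≤sum-map g (All.map (λ e → ≤-reflexive (cong toℕ (sym e))) heavy))
                                                  (length*≤sum-map g (All.map 1≤toℕ nonzero)) ⟩
    sum (map g hs) + sum (map g ws)    ≡⟨ sum-++ (map g hs) (map g ws) ⟨
    sum (map g hs ++ map g ws)         ≡⟨ cong sum (map-++ g hs ws) ⟨
    sum (map g (hs ++ ws))             ≤⟨ weight-≥ f hs++ws! ⟩
    weight f                           ∎
    where
    open ≤-Reasoning
    g : Cell r t → ℕ
    g = toℕ ∘ f ∘ vertex

  zero⇒fresh-heavy : ∀ {w hs} → f (vertex w) ≡ zero → All (Collinear w) hs → ∃ λ h → Heavy h × All (h ≢_) hs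
  zero⇒fresh-heavy {w} fw≡0 collinear with IsRDF⇒IsCellRDF rdf w fw≡0
  ... | h , apart , heavy =
    h , heavy , All.map (λ w~p h≡p → collinear⇒¬apart (subst (Collinear w) (sym h≡p) w~p) apart) collinear

  bound-by-extension : ∀ {hs k m} → All Heavy hs → Unique hs → CollinearExtension hs k →
                       m ≤ length hs * 2 + k → (∀ {h} → Heavy h → Unique (h ∷ hs) → m ≤ weight f) →
                       m ≤ weight f
  bound-by-extension heavy hs! (ws , refl , hs++ws! , collinear) m≤count next
    with All.all? (λ w → ¬? (f (vertex w) ≟ zero)) ws
  ... | yes nonzero = ≤-trans m≤count (weight-≥-count heavy nonzero hs++ws!)
  ... | no ¬nonzero with find (¬All⇒Any¬ (λ w → ¬? (f (vertex w) ≟ zero)) ws ¬nonzero)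
  ...   | w , w∈ws , ¬fw≢0 with zero⇒fresh-heavy (decidable-stable (f (vertex w) ≟ zero) ¬fw≢0) (All.lookup collinear w∈ws)
  ...     | h , heavy-h , h∉hs = next heavy-h (h∉hs ∷ hs!)

  bound-by-some-heavy : ∀ {m} → m ≤ r * t → (∀ {p} → Heavy p → m ≤ weight f) → m ≤ weight f
  bound-by-some-heavy m≤rt next with any? (λ u → f u ≟ two)
  ... | yes (u , fu≡2) = next (trans (cong f (combine-remQuot {r} t u)) fu≡2)
  ... | no ¬heavy = ≤-trans m≤rt (begin
    r * t                                ≡⟨ trans (*-identityʳ _) (length-tabulate id) ⟨
    length (allFin (r * t)) * 1          ≤⟨ length*≤sum-map (toℕ ∘ f) (tabulate⁺ (1≤toℕ ∘ nonzero)) ⟩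
    weight f                             ∎)
    where
    open ≤-Reasoning
    nonzero : ∀ u → f u ≢ zero
    nonzero u fu≡0 = let v , _ , fv≡2 = rdf u fu≡0 in ¬heavy (v , fv≡2)

  weight≥4 : 1 < r → 1 < t → 4 ≤ weight f
  weight≥4 1<r 1<t =
    bound-by-some-heavy (*-mono-≤ 1<r 1<t) λ {p} heavy-p →
    bound-by-extension (heavy-p ∷ []) ([] ∷ []) (neighbours₂ 1<r 1<t p) ≤-refl λ heavy-q q∷p! →
    weight-≥-count (heavy-q ∷ heavy-p ∷ []) [] q∷p!

  weight≥5 : 2 < r → 2 < t → 5 ≤ weight f
  weight≥5 2<r 2<t =
    bound-by-some-heavy (≤-trans (m≤m+n 5 4) (*-mono-≤ 2<r 2<t)) λ {p} heavy-p →
    bound-by-extension (heavy-p ∷ []) ([] ∷ []) (neighbours₄ 2<r 2<t p) (n≤1+n 5) λ heavy-q q∷p! →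
    bound-by-extension (heavy-q ∷ heavy-p ∷ []) q∷p! (commonCells₁ 2<r 2<t q∷p!) ≤-refl λ heavy-h h∷q∷p! →
    ≤-trans (n≤1+n 5) (weight-≥-count (heavy-h ∷ heavy-q ∷ heavy-p ∷ []) [] h∷q∷p!)

  weight≥6 : 3 < r → 3 < t → 6 ≤ weight f
  weight≥6 3<r 3<t =
    bound-by-some-heavy (≤-trans (m≤m+n 6 10) (*-mono-≤ 3<r 3<t)) λ {p} heavy-p →
    bound-by-extension (heavy-p ∷ []) ([] ∷ []) (neighbours₄ (<⇒≤ 3<r) (<⇒≤ 3<t) p) ≤-refl λ heavy-q q∷p! →
    bound-by-extension (heavy-q ∷ heavy-p ∷ []) q∷p! (commonCells₂ 3<r 3<t q∷p!) ≤-refl λ heavy-h h∷q∷p! →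
    weight-≥-count (heavy-h ∷ heavy-q ∷ heavy-p ∷ []) [] h∷q∷p!

firstColumn₂ : ∀ {t} → List (Cell 2 (1 + t) × Fin 3)
firstColumn₂ = ((zero , zero) , two) ∷ ((suc zero , zero) , two) ∷ []

firstColumn₂-RDF : ∀ {t} → IsCellRDF (assign (firstColumn₂ {t}))
firstColumn₂-RDF (zero , zero)        ()
firstColumn₂-RDF (suc zero , zero)    ()
firstColumn₂-RDF (zero , suc _)     _ = (suc zero , zero) , ((λ ()) , (λ ())) , refl
firstColumn₂-RDF (suc zero , suc _) _ = (zero , zero) , ((λ ()) , (λ ())) , refl

firstColumn₃ : ∀ {t} → List (Cell 3 (1 + t) × Fin 3)
firstColumn₃ = ((zero , zero) , two) ∷ ((suc zero , zero) , two) ∷ ((suc (suc zero) , zero) , suc zero) ∷ []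

firstColumn₃-RDF : ∀ {t} → IsCellRDF (assign (firstColumn₃ {t}))
firstColumn₃-RDF (zero , zero)             ()
firstColumn₃-RDF (suc zero , zero)         ()
firstColumn₃-RDF (suc (suc zero) , zero)   ()
firstColumn₃-RDF (zero , suc _)          _ = (suc zero , zero) , ((λ ()) , (λ ())) , refl
firstColumn₃-RDF (suc _ , suc _)         _ = (zero , zero) , ((λ ()) , (λ ())) , refl

diagonal : ∀ {r t} → List (Cell (3 + r) (3 + t) × Fin 3)
diagonal = ((zero , zero) , two) ∷ ((suc zero , suc zero) , two) ∷ ((suc (suc zero) , suc (suc zero)) , two) ∷ []

diagonal-RDF : ∀ {r t} → IsCellRDF (assign (diagonal {r} {t}))
diagonal-RDF (zero , zero)             _ = (suc zero , suc zero) , ((λ ()) , (λ ())) , refl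
diagonal-RDF (zero , suc zero)         _ = (suc (suc zero) , suc (suc zero)) , ((λ ()) , (λ ())) , refl
diagonal-RDF (zero , suc (suc _))      _ = (suc zero , suc zero) , ((λ ()) , (λ ())) , refl
diagonal-RDF (suc zero , zero)         _ = (suc (suc zero) , suc (suc zero)) , ((λ ()) , (λ ())) , refl
diagonal-RDF (suc zero , suc _)        _ = (zero , zero) , ((λ ()) , (λ ())) , refl
diagonal-RDF (suc (suc _) , zero)      _ = (suc zero , suc zero) , ((λ ()) , (λ ())) , refl
diagonal-RDF (suc (suc _) , suc _)     _ = (zero , zero) , ((λ ()) , (λ ())) , refl

γR[K₂×K] : ∀ {r t} → r ≡ 2 → r ≤ t → RomanDominationNumber (K r ×ᵍ K t) 4
γR[K₂×K] refl 2≤t@(s≤s (s≤s _)) =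
  RomanDominationNumber-intro (λ _ rdf → LowerBounds.weight≥4 rdf ≤-refl 2≤t) firstColumn₂ firstColumn₂-RDF ≤-refl

γR[K₃×K] : ∀ {r t} → r ≡ 3 → r ≤ t → RomanDominationNumber (K r ×ᵍ K t) 5
γR[K₃×K] refl 3≤t@(s≤s (s≤s (s≤s _))) =
  RomanDominationNumber-intro (λ _ rdf → LowerBounds.weight≥5 rdf ≤-refl 3≤t) firstColumn₃ firstColumn₃-RDF ≤-refl

γR[K×K] : ∀ {r t} → 3 < r → r ≤ t → RomanDominationNumber (K r ×ᵍ K t) 6
γR[K×K] 3<r@(s≤s (s≤s (s≤s (s≤s _)))) r≤t@(s≤s (s≤s (s≤s (s≤s _)))) =
  RomanDominationNumber-intro (λ _ rdf → LowerBounds.weight≥6 rdf 3<r (≤-trans 3<r r≤t)) diagonal diagonal-RDF ≤-refl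

proposition2p1 : (r t : ℕ) →
    ((r ≡ 2 → r ≤ t → RomanDominationNumber (K r ×ᵍ K t) 4)
    × (r ≡ 3 → r ≤ t → RomanDominationNumber (K r ×ᵍ K t) 5)
    × (3 < r → r ≤ t → RomanDominationNumber (K r ×ᵍ K t) 6))
proposition2p1 r t = γR[K₂×K] , γR[K₃×K] , γR[K×K]
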